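{- Let $SP=\{Pre\}(\mathcal{R},s)\{Post\}$ be an annotated specification, i.e. $Pre$ and $Post$ are formulas, $\mathcal{R}$ is a logically decorated graph rewriting system and $s$ is an annotated strategy over $\mathcal{R}$. If the formula $correct(SP)=(Pre\Rightarrow wp(s,Post))\wedge vc(s,Post)$ is valid (satisfied by every graph), then for all graphs $G$, $G'$ such that $G\Rightarrow_s G'$, $G\models Pre$ implies $G'\models Post$.
   Context: Fix a logic $\mathcal{L}$. A logically decorated graph over $(\mathcal{C},\mathcal{R})$, $\mathcal{C},\mathcal{R}\subseteq\mathcal{L}$, with basic concepts $\mathcal{C}_0\subseteq\mathcal{C}$ and basic roles $\mathcal{R}_0\subseteq\mathcal{R}$, is $G=(N,E,\Phi_N,\Phi_E,s,t)$ with $\Phi_N:N\to\mathcal{P}(\mathcal{C})$, $\Phi_E:E\to\mathcal{R}$, $s,t:E\to N$. Elementary actions and their effect $G[a]$: $add_N(i)$ adds a fresh node $i$ with no edges and empty label; $del_N(i)$ removes $i$ and all edges incident to it; $add_C(i,c)$ ($c\in\mathcal{C}_0$) adds $c$ to $\Phi_N(i)$; $del_C(i,c)$ removes $c$ from $\Phi_N(i)$; $add_E(e,i,j,r)$ ($r\in\mathcal{R}_0$) adds a fresh edge $e$ from $i$ to $j$ labelled $r$; $del_E(e,i,j,r)$ removes edge $e$; $i\gg j$ makes every edge with target $i$ have target $j$; $mrg(i,j)$ deletes node $j$, sets $\Phi_N(i):=\Phi_N(i)\cup\Phi_N(j)$, and replaces $j$ by $i$ as source/target of every edge; $cl(i,j,R_{in},R_{out},R_{lin},R_{lout},R_{ll})$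 (parameters are subsets of $\mathcal{R}_0$) adds a new node $j$ with $\Phi_N(j)=\Phi_N(i)\cap\mathcal{C}_0$ and, with the same label as the original edge $e$: a fresh edge $s(e)\to j$ for every non-loop $e$ with target $i$ and label in $R_{in}$; a fresh edge $j\to t(e)$ for every non-loop $e$ with source $i$ and label in $R_{out}$; for every loop $e$ at $i$, a fresh edge $i\to j$ if its label is in $R_{lin}$, a fresh edge $j\to i$ if in $R_{lout}$, a fresh loop at $j$ if in $R_{ll}$. An action is a sequence $a_1;\dots;a_n$ with $G[a;\alpha]=(G[a])[\alpha]$, $G[\epsilon]=G$. A rule is $\rho=(L,\alpha_\rho)$ with $L$ a logically decorated graph and $\alpha_\rho$ an action over node names of $L$; a rewriting system $\mathcal{R}$ is a set of rules. A match from $L$ to $G$ is $h=(h^N,h^E)$, $h^N:N^L\to N^G$, $h^E:E^L\to E^G$, such that every $h^N(n)$ satisfies every formula in $\Phi_N^L(n)$, $\Phi_E^G(h^E(e))=\Phi_E^L(e)$, $s^G(h^E(e))=h^N(s^L(e))$ and $t^G(h^E(e))=h^N(t^L(e))$. $G\to_\rho G'$ iff there is a match $h$ and $G'=G[h(\alpha_\rho)]$ ($h(\alpha_\rho)$ replaces node names $n$ of $L$ by $h^N(n)$). Strategies: $s::=\epsilon\mid\rho\mid s\oplus s\mid s;s\mid s^*\mid\rho?\mid\rho!$ ($\rho\in\mathcal{R}$); in an annotated strategy every $s^*$ carries an invariant formula $inv_s$. $G\models App(\rho)$ and $G\models App(\rho!)$ iff there is a match from the left-hand side of $\rho$ to $G$;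 $App(\epsilon)$, $App(s^*)$, $App(\rho?)$ always hold; $App(s_0\oplus s_1)$ iff $App(s_0)$ or $App(s_1)$; $App(s_0;s_1)$ iff $App(s_0)$. The relation $G\Rightarrow_s G'$ is the least one given by: $G\Rightarrow_\epsilon G$; $G\Rightarrow_{s_0;s_1}G'$ if $G\Rightarrow_{s_0}G''$ and $G''\Rightarrow_{s_1}G'$; $G\Rightarrow_{s_0\oplus s_1}G'$ if $G\Rightarrow_{s_0}G'$ or $G\Rightarrow_{s_1}G'$; $G\Rightarrow_{s^*}G$ if $G\not\models App(s)$; $G\Rightarrow_{s^*}G'$ if $G\models App(s)$, $G\Rightarrow_s G''$ and $G''\Rightarrow_{s^*}G'$; for $\rho$, $\rho!$, $\rho?$: $G\Rightarrow G'$ if $G\models App(\rho)$ and $G\to_\rho G'$; if $G\not\models App(\rho)$ then $G\Rightarrow_\rho\top$ where $\top$ is a special successful-termination outcome (not a graph), $\rho!$ has no result (failure), and $G\Rightarrow_{\rho?}G$. Formulas: formulas of $\mathcal{L}$ closed under $\neg,\wedge,\vee,\Rightarrow$, together with atoms $App(s)$ and substitution formulas $\phi[a]$ with $G\models\phi[a]$ iff $G[a]\models\phi$ (formulas may mention the node names used in rules). Weakest preconditions: $wp(a,Q)=Q[a]$, $wp(a;\alpha,Q)=wp(a,wp(\alpha,Q))$; $wp(\epsilon,Q)=Q$; $wp(s_0;s_1,Q)=wp(s_0,wp(s_1,Q))$; $wp(s_0\oplus s_1,Q)=wp(s_0,Q)\wedge wp(s_1,Q)$; $wp(s^*\{inv_s\},Q)=inv_s$;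 $wp(\rho,Q)=App(\rho)\Rightarrow wp(\alpha_\rho,Q)$; $wp(\rho!,Q)=App(\rho)\wedge wp(\alpha_\rho,Q)$; $wp(\rho?,Q)=(App(\rho)\Rightarrow wp(\alpha_\rho,Q))\wedge(\neg App(\rho)\Rightarrow Q)$. Verification conditions: $vc(\epsilon,Q)=vc(\rho,Q)=vc(\rho!,Q)=vc(\rho?,Q)=\top$ (true); $vc(s_0;s_1,Q)=vc(s_0,wp(s_1,Q))\wedge vc(s_1,Q)$; $vc(s_0\oplus s_1,Q)=vc(s_0,Q)\wedge vc(s_1,Q)$; $vc(s^*\{inv_s\},Q)=vc(s,inv_s)\wedge(inv_s\wedge App(s)\Rightarrow wp(s,inv_s))\wedge(inv_s\wedge\neg App(s)\Rightarrow Q)$. -}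

module Defs where

open import Data.Nat using (ℕ; zero; suc; _≡ᵇ_; _⊔_)
open import Data.Bool using (Bool; true; false; if_then_else_; not; _∧_; _∨_; T)
open import Data.List using (List; []; _∷_; _++_; filterᵇ; concatMap; foldr)
open import Data.Bool.ListAction using (any)
open import Data.Sum using (_⊎_)
open import Data.List.Membership.Propositional using (_∈_)
open import Data.List.Relation.Unary.All using (All)
open import Data.Product using (Σ; _×_; _,_)
open import Data.Unit using (⊤)
open import Function using (_∘_)
open import Relation.Nullary using (¬_)
open import Relation.Nullary.Decidable using (⌊_⌋)
open import Relation.Binary.Definitions using (DecidableEquality)
open import Relation.Binary.PropositionalEquality using (_≡_)

-- N = nodes, E = edges, Φ_N = ΦN, Φ_E = ΦE, s = src, t = tgt.
-- (Total functions on names; only their values on the listed nodes /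
-- edges are meaningful.)

record Graph (C R : Set) : Set where
  field
    nodes : List ℕ
    edges : List ℕ
    ΦN    : ℕ → List C
    ΦE    : ℕ → R
    src   : ℕ → ℕ
    tgt   : ℕ → ℕ
open Graph public

-- The fixed logic 𝓛: concepts C (with basic concepts C₀ given by basicC),
-- roles R (with basic roles R₀ given by basicR), and the satisfaction of
-- a concept by a node of a graph.

record Logic : Set₁ where
  field
    C      : Set
    R      : Set
    _≟C_   : DecidableEquality C
    _≟R_   : DecidableEquality R
    basicC : C → Bool
    basicR : R → Bool
    sat    : Graph C R → ℕ → C → Set

module _ (𝓛 : Logic) where
  open Logic 𝓛

  Gr : Set
  Gr = Graph C R

  Form : Set₁
  Form = Gr → Set

  Valid : Form → Set
  Valid φ = ∀ G → φ G

  data Act : Set where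
    addN  : ℕ → Act
    delN  : ℕ → Act
    addC  : ℕ → (c : C) → T (basicC c) → Act
    delC  : ℕ → C → Act
    addE  : (e i j : ℕ) → (r : R) → T (basicR r) → Act
    delE  : (e i j : ℕ) → R → Act
    redir : ℕ → ℕ → Act
    mrg   : ℕ → ℕ → Act
    cl    : (i j : ℕ) → (Rin Rout Rlin Rlout Rll : List R) →
            All (T ∘ basicR) Rin → All (T ∘ basicR) Rout →
            All (T ∘ basicR) Rlin → All (T ∘ basicR) Rlout →
            All (T ∘ basicR) Rll → Act

  Action : Set
  Action = List Act

  upd : {A : Set} → (ℕ → A) → ℕ → A → ℕ → A
  upd f k v n = if n ≡ᵇ k then v else f n

  without : ℕ → List ℕ → List ℕ
  without k = filterᵇ (λ n → not (n ≡ᵇ k))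

  eqC : C → C → Bool
  eqC c d = ⌊ c ≟C d ⌋

  memR : R → List R → Bool
  memR r = any (λ x → ⌊ r ≟R x ⌋)

  incident : Gr → ℕ → ℕ → Bool
  incident G i e = (src G e ≡ᵇ i) ∨ (tgt G e ≡ᵇ i)

  doDelN : ℕ → Gr → Gr
  doDelN i G = record G
    { nodes = without i (nodes G)
    ; edges = filterᵇ (λ e → not (incident G i e)) (edges G) }

  doAddN : ℕ → Gr → Gr
  doAddN i G = record (doDelN i G)
    { nodes = i ∷ without i (nodes G)
    ; ΦN    = upd (ΦN G) i [] }

  putE : (e i j : ℕ) → R → Gr → Gr
  putE e i j r G = record G
    { edges = e ∷ without e (edges G)
    ; src   = upd (src G) e i
    ; tgt   = upd (tgt G) e j
    ; ΦE    = upd (ΦE G) e r }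

  freshE : Gr → ℕ
  freshE G = suc (foldr _⊔_ 0 (edges G))

  addAll : ℕ → List (ℕ × ℕ × R) → Gr → Gr
  addAll k [] H = H
  addAll k ((a , b , r) ∷ xs) H = addAll (suc k) xs (putE k a b r H)

  doCl : (i j : ℕ) → (Rin Rout Rlin Rlout Rll : List R) → Gr → Gr
  doCl i j Rin Rout Rlin Rlout Rll G =
      addAll (freshE G) (concatMap new (edges G)) G0
    where
      G1 = doAddN j G
      G0 = record G1 { ΦN = upd (ΦN G1) j (filterᵇ basicC (ΦN G i)) }
      opt : ℕ → List R → ℕ → ℕ → List (ℕ × ℕ × R)
      opt e X a b = if memR (ΦE G e) X then (a , b , ΦE G e) ∷ [] else []
      new : ℕ → List (ℕ × ℕ × R)
      new e =
        if (src G e ≡ᵇ i) ∧ (tgt G e ≡ᵇ i)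
        then opt e Rlin i j ++ (opt e Rlout j i ++ opt e Rll j j)
        else (if tgt G e ≡ᵇ i then opt e Rin (src G e) j
        else (if src G e ≡ᵇ i then opt e Rout j (tgt G e) else []))

  step : Act → Gr → Gr
  step (addN i) G = doAddN i G
  step (delN i) G = doDelN i G
  step (addC i c _) G =
    record G { ΦN = upd (ΦN G) i (c ∷ filterᵇ (λ d → not (eqC d c)) (ΦN G i)) }
  step (delC i c) G =
    record G { ΦN = upd (ΦN G) i (filterᵇ (λ d → not (eqC d c)) (ΦN G i)) }
  step (addE e i j r _) G = putE e i j r G
  step (delE e _ _ _) G = record G { edges = without e (edges G) }
  step (redir i j) G =
    record G { tgt = λ e → if tgt G e ≡ᵇ i then j else tgt G e }
  step (mrg i j) G =
    if i ≡ᵇ j then G else record G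
      { nodes = without j (nodes G)
      ; ΦN    = upd (ΦN G) i (ΦN G i ++ ΦN G j)
      ; src   = λ e → rep (src G e)
      ; tgt   = λ e → rep (tgt G e) }
    where rep : ℕ → ℕ
          rep n = if n ≡ᵇ j then i else n
  step (cl i j Rin Rout Rlin Rlout Rll _ _ _ _ _) G = doCl i j Rin Rout Rlin Rlout Rll G

  apply : Action → Gr → Gr
  apply [] G = G
  apply (a ∷ α) G = apply α (step a G)

  record Rule : Set where
    field
      lhs : Gr
      act : Action
  open Rule public

  RS : Set₁
  RS = Rule → Set

  record IsMatch (L G : Gr) (hN hE : ℕ → ℕ) : Set where
    field
      nodeMap : ∀ n → n ∈ nodes L → hN n ∈ nodes G
      nodeSat : ∀ n → n ∈ nodes L → ∀ c → c ∈ ΦN L n → sat G (hN n) c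
      edgeMap : ∀ e → e ∈ edges L → hE e ∈ edges G
      edgeLab : ∀ e → e ∈ edges L → ΦE G (hE e) ≡ ΦE L e
      edgeSrc : ∀ e → e ∈ edges L → src G (hE e) ≡ hN (src L e)
      edgeTgt : ∀ e → e ∈ edges L → tgt G (hE e) ≡ hN (tgt L e)

  memℕ : ℕ → List ℕ → Bool
  memℕ n = any (λ m → n ≡ᵇ m)

  instAct : Gr → (hN hE : ℕ → ℕ) → Act → Act
  instAct L hN hE a = go a
    where
      n' : ℕ → ℕ
      n' n = if memℕ n (nodes L) then hN n else n
      e' : ℕ → ℕ
      e' e = if memℕ e (edges L) then hE e else e
      go : Act → Act
      go (addN i) = addN (n' i)
      go (delN i) = delN (n' i)
      go (addC i c p) = addC (n' i) c p
      go (delC i c) = delC (n' i) c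
      go (addE e i j r p) = addE (e' e) (n' i) (n' j) r p
      go (delE e i j r) = delE (e' e) (n' i) (n' j) r
      go (redir i j) = redir (n' i) (n' j)
      go (mrg i j) = mrg (n' i) (n' j)
      go (cl i j a b c d f p q u v w) = cl (n' i) (n' j) a b c d f p q u v w

  inst : Gr → (hN hE : ℕ → ℕ) → Action → Action
  inst L hN hE [] = []
  inst L hN hE (a ∷ α) = instAct L hN hE a ∷ inst L hN hE α

  AppR : Rule → Form
  AppR ρ G = Σ (ℕ → ℕ) λ hN → Σ (ℕ → ℕ) λ hE → IsMatch (lhs ρ) G hN hE

  RewR : Rule → Gr → Gr → Set
  RewR ρ G G' = Σ (ℕ → ℕ) λ hN → Σ (ℕ → ℕ) λ hE →
    IsMatch (lhs ρ) G hN hE × G' ≡ apply (inst (lhs ρ) hN hE (act ρ)) G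

  data Strat (ℛ : RS) : Set₁ where
    eps  : Strat ℛ
    rule : (ρ : Rule) → ℛ ρ → Strat ℛ
    _⊕_  : Strat ℛ → Strat ℛ → Strat ℛ
    _⨾_  : Strat ℛ → Strat ℛ → Strat ℛ
    star : Strat ℛ → (inv : Form) → Strat ℛ
    try  : (ρ : Rule) → ℛ ρ → Strat ℛ
    must : (ρ : Rule) → ℛ ρ → Strat ℛ

  App : {ℛ : RS} → Strat ℛ → Form
  App eps G = ⊤
  App (rule ρ _) G = AppR ρ G
  App (s₀ ⊕ s₁) G = App s₀ G ⊎ App s₁ G
  App (s₀ ⨾ s₁) G = App s₀ G
  App (star s _) G = ⊤
  App (try ρ _) G = ⊤
  App (must ρ _) G = AppR ρ G

  data Outcome : Set where
    graph : Gr → Outcome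
    top   : Outcome           -- the successful-termination outcome ⊤

  data Runs {ℛ : RS} : Gr → Strat ℛ → Outcome → Set₁ where
    r-eps   : ∀ {G} → Runs G eps (graph G)
    r-seq   : ∀ {G G'' o s₀ s₁} → Runs G s₀ (graph G'') → Runs G'' s₁ o →
              Runs G (s₀ ⨾ s₁) o
    r-orL   : ∀ {G o s₀ s₁} → Runs G s₀ o → Runs G (s₀ ⊕ s₁) o
    r-orR   : ∀ {G o s₀ s₁} → Runs G s₁ o → Runs G (s₀ ⊕ s₁) o
    r-stop  : ∀ {G s inv} → ¬ App s G → Runs G (star s inv) (graph G)
    r-iter  : ∀ {G G'' o s inv} → App s G → Runs G s (graph G'') →
              Runs G'' (star s inv) o → Runs G (star s inv) o
    r-rule  : ∀ {G G' ρ p} → AppR ρ G → RewR ρ G G' → Runs G (rule ρ p) (graph G')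
    r-ruleT : ∀ {G ρ p} → ¬ AppR ρ G → Runs G (rule ρ p) top
    r-must  : ∀ {G G' ρ p} → AppR ρ G → RewR ρ G G' → Runs G (must ρ p) (graph G')
    r-try   : ∀ {G G' ρ p} → AppR ρ G → RewR ρ G G' → Runs G (try ρ p) (graph G')
    r-tryN  : ∀ {G ρ p} → ¬ AppR ρ G → Runs G (try ρ p) (graph G)

  wpA : Action → Form → Form
  wpA α Q G = Q (apply α G)

  -- App(ρ) ⇒ wp(α_ρ, Q), the node names of the lhs being those of the match
  AppImp : Rule → Form → Form
  AppImp ρ Q G = ∀ hN hE → IsMatch (lhs ρ) G hN hE →
                 wpA (inst (lhs ρ) hN hE (act ρ)) Q G

  wp : {ℛ : RS} → Strat ℛ → Form → Form
  wp eps Q = Q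
  wp (rule ρ _) Q = AppImp ρ Q
  wp (s₀ ⊕ s₁) Q G = wp s₀ Q G × wp s₁ Q G
  wp (s₀ ⨾ s₁) Q = wp s₀ (wp s₁ Q)
  wp (star s inv) Q = inv
  wp (try ρ _) Q G = AppImp ρ Q G × (¬ AppR ρ G → Q G)
  wp (must ρ _) Q G = AppR ρ G × AppImp ρ Q G

  vc : {ℛ : RS} → Strat ℛ → Form → Form
  vc eps Q G = ⊤
  vc (rule ρ _) Q G = ⊤
  vc (try ρ _) Q G = ⊤
  vc (must ρ _) Q G = ⊤
  vc (s₀ ⨾ s₁) Q G = vc s₀ (wp s₁ Q) G × vc s₁ Q G
  vc (s₀ ⊕ s₁) Q G = vc s₀ Q G × vc s₁ Q G
  vc (star s inv) Q G =
    vc s inv G × (inv G × App s G → wp s inv G) × (inv G × ¬ App s G → Q G)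

  correct : {ℛ : RS} → Form → Strat ℛ → Form → Form
  correct Pre s Post G = (Pre G → wp s Post G) × vc s Post G

module Submission where

open import Defs
open import Data.Product using (_×_; _,_; proj₁; proj₂)
open import Relation.Nullary using (¬_)
open import Relation.Binary.PropositionalEquality using (refl)

-- Validity of vc (not merely its truth at G)
-- is what makes this go through: a loop must re-establish its invariant
-- at every graph reached by iterating the body.

module _ {𝓛 : Logic} where

  valid-proj₁ : {φ ψ : Form 𝓛} → Valid 𝓛 (λ G → φ G × ψ G) → Valid 𝓛 φ
  valid-proj₁ V G = proj₁ (V G)

  valid-proj₂ : {φ ψ : Form 𝓛} → Valid 𝓛 (λ G → φ G × ψ G) → Valid 𝓛 ψ
  valid-proj₂ V G = proj₂ (V G)

  rewrite-establishes : ∀ ρ (Q : Form 𝓛) {G G'} →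
    AppImp 𝓛 ρ Q G → RewR 𝓛 ρ G G' → Q G'
  rewrite-establishes ρ Q w (hN , hE , match , refl) = w hN hE match

  module _ {ℛ : RS 𝓛} where

    wp-sound : (s : Strat 𝓛 ℛ) {Q : Form 𝓛} {G G' : Gr 𝓛} →
      Valid 𝓛 (vc 𝓛 s Q) → Runs 𝓛 G s (graph G') → wp 𝓛 s Q G → Q G'
    wp-sound eps V r-eps w = w
    wp-sound (s₀ ⨾ s₁) V (r-seq r₀ r₁) w =
      wp-sound s₁ (valid-proj₂ V) r₁ (wp-sound s₀ (valid-proj₁ V) r₀ w)
    wp-sound (s₀ ⊕ s₁) V (r-orL r) (w₀ , _) = wp-sound s₀ (valid-proj₁ V) r w₀
    wp-sound (s₀ ⊕ s₁) V (r-orR r) (_ , w₁) = wp-sound s₁ (valid-proj₂ V) r w₁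
    wp-sound (star s inv) {Q} {G} V (r-stop stuck) i = exit (i , stuck)
      where exit : inv G × ¬ App 𝓛 s G → Q G
            exit = proj₂ (proj₂ (V G))
    wp-sound (star s inv) {G = G} V (r-iter app r rs) i =
      wp-sound (star s inv) V rs (wp-sound s (valid-proj₁ V) r (preserve (i , app)))
      where preserve : inv G × App 𝓛 s G → wp 𝓛 s inv G
            preserve = proj₁ (proj₂ (V G))
    wp-sound (rule ρ _) {Q} V (r-rule _ rw) w = rewrite-establishes ρ Q w rw
    wp-sound (must ρ _) {Q} V (r-must _ rw) (_ , w) = rewrite-establishes ρ Q w rw
    wp-sound (try ρ _) {Q} V (r-try _ rw) (w , _) = rewrite-establishes ρ Q w rw
    wp-sound (try ρ _) V (r-tryN stuck) (_ , w) = w stuck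

mainTheorem2 : (𝓛 : Logic) (ℛ : RS 𝓛) (Pre Post : Form 𝓛) (s : Strat 𝓛 ℛ) →
    Valid 𝓛 (correct 𝓛 Pre s Post) →
    (G G' : Gr 𝓛) → Runs 𝓛 G s (graph G') → Pre G → Post G'
mainTheorem2 𝓛 ℛ Pre Post s valid G G' run pre =
  wp-sound s (λ H → proj₂ (valid H)) run (proj₁ (valid G) pre)
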